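{- Let $k,t:\mathbb N\to\mathbb N$ satisfy $1\le t(m)\le k(m)\le m$ for all $m$ and $k(m)=o(m)$. Suppose there exists $c>0$ such that $t(m)\le c\sqrt{k(m)}$ for infinitely many $m$. Then \[ \limsup_{m\to\infty}\frac{M_0(2m,m,k(m),t(m))}{\binom{2m}{m}}>0. \]
   Context: A family $\mathcal A$ of sets is $t$-intersecting if $|E\cap F|\ge t$ for all $E,F\in\mathcal A$. For a family $X$ of subsets of $[n]$, $\nabla_m(X)=\{y\subseteq[n]:|y|=m,\ x\subseteq y\text{ for some }x\in X\}$. For $1\le t\le k\le m\le n$, $M_0(n,m,k,t)$ is the maximum of $|\nabla_m(\mathcal A)|$ over all $t$-intersecting families $\mathcal A$ of $k$-element subsets of $[n]$. -}

module Defs where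

open import Data.Bool using (Bool; true; false; _∧_; _∨_; not; if_then_else_)
open import Data.Nat using (ℕ; zero; suc; _⊔_; _≡ᵇ_; _≤ᵇ_)
open import Data.List using (List; []; _∷_; map; _++_; filter; foldr; length)
open import Data.Bool.ListAction using (all; any)
open import Data.Vec using (Vec; []; _∷_)
open import Data.Fin.Subset using (Subset; _∩_; ∣_∣; inside; outside)
open import Relation.Nullary.Decidable using (T?)

allSubsets : (n : ℕ) → List (Subset n)
allSubsets zero = [] ∷ []
allSubsets (suc n) = map (inside ∷_) (allSubsets n) ++ map (outside ∷_) (allSubsets n)

-- All sub-lists of a list (each subfamily of a duplicate-free list exactly once).
sublists : {A : Set} → List A → List (List A)
sublists [] = [] ∷ []
sublists (x ∷ xs) = map (x ∷_) (sublists xs) ++ sublists xs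

_⊆ᵇ_ : {n : ℕ} → Subset n → Subset n → Bool
[] ⊆ᵇ [] = true
(a ∷ x) ⊆ᵇ (b ∷ y) = (not a ∨ b) ∧ (x ⊆ᵇ y)

kSubsets : (n k : ℕ) → List (Subset n)
kSubsets n k = filter (λ x → T? (∣ x ∣ ≡ᵇ k)) (allSubsets n)

tIntersectingᵇ : {n : ℕ} → ℕ → List (Subset n) → Bool
tIntersectingᵇ t A = all (λ E → all (λ F → t ≤ᵇ ∣ E ∩ F ∣) A) A

nabla : (n m : ℕ) → List (Subset n) → List (Subset n)
nabla n m X = filter (λ y → T? ((∣ y ∣ ≡ᵇ m) ∧ any (λ x → x ⊆ᵇ y) X)) (allSubsets n)

M0 : (n m k t : ℕ) → ℕ
M0 n m k t =
  foldr _⊔_ 0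
    (map (λ A → length (nabla n m A))
         (filter (λ A → T? (tIntersectingᵇ t A)) (sublists (kSubsets n k))))

module Submission where

open import Defs
open import Data.Nat using (ℕ; _≤_; _*_; _+_)
open import Data.Nat.Combinatorics using (_C_)
open import Data.Product using (_×_; ∃-syntax)
open import Data.Nat
open import Data.Nat.Properties
open import Data.Nat.Combinatorics using (nCk+nC[k+1]≡[n+1]C[k+1]; nCk≡nC[n∸k])
open import Data.Nat.DivMod using (_/_; _%_; m≡m%n+[m/n]*n; m%n<n; m/n*n≤m)
open import Data.Nat.Tactic.RingSolver using (solve-∀)
open import Data.Bool using (Bool; true; false; _∧_; T)
open import Data.Bool.Properties using (∧-identityʳ; ∧-zeroʳ)
open import Data.Bool.ListAction using (any)
open import Data.Empty using (⊥-elim)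
open import Data.Fin.Subset using (Subset; _∩_; ∣_∣; inside; outside)
open import Data.List using (List; []; _∷_; map; _++_; filter; foldr; length)
open import Data.List.Membership.Propositional using (_∈_; lose)
open import Data.List.Membership.Propositional.Properties using (∈-filter⁺; ∈-filter⁻; ∈-map⁺; ∈-++⁺ˡ; ∈-++⁺ʳ)
open import Data.List.Relation.Unary.All using (tabulate)
open import Data.List.Relation.Unary.All.Properties using (all⁻)
open import Data.List.Relation.Unary.Any using (here; there)
open import Data.List.Relation.Unary.Any.Properties using (any⁺)
open import Data.Vec using ([]; _∷_)
open import Data.Product using (_,_; proj₁; proj₂)
open import Relation.Binary.PropositionalEquality
open import Relation.Nullary using (¬_; does; yes; no; contradiction)
open import Relation.Nullary.Decidable using (T?)
open import Relation.Unary using (Decidable)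

-- Put s = 2k − t and S = {0, …, s − 1} ⊆ [2m].  The k-subsets of S form a
-- t-intersecting family whose m-shadow contains every m-set meeting S in ≥ k points.
-- With weight m s j = C(s, j)·C(2m − s, m − j), the number of m-sets meeting S in exactly
-- j points, and upper m s d = ∑_{j ≥ d} weight m s j, this gives upper m s k ≤ M₀ and
-- upper m s 0 = C(2m, m).
--
-- The weights are symmetric about
-- s/2, so upper m s 0 ≤ 2·upper m s d for d = k − ⌊t/2⌋.  A tail can be shifted by g at the
-- cost of a factor 3 when each weight is at most twice the one g places further on; from
-- the exact ratio of consecutive weights and a Bernoulli-type estimate this holds near the
-- centre for blocks of length ≈ t/B, B = 48c + 1, provided s ≥ 24(B + 1).  For smaller s
-- the crude ratio bound 2s is enough.

∑ : (ℕ → ℕ) → ℕ → ℕ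
∑ f zero = 0
∑ f (suc n) = f 0 + ∑ (λ i → f (suc i)) n

∑-cong : ∀ n {f g : ℕ → ℕ} → (∀ i → i < n → f i ≡ g i) → ∑ f n ≡ ∑ g n
∑-cong zero eq = refl
∑-cong (suc n) eq = cong₂ _+_ (eq 0 z<s) (∑-cong n (λ i i<n → eq (suc i) (s<s i<n)))

∑-mono : ∀ n {f g : ℕ → ℕ} → (∀ i → i < n → f i ≤ g i) → ∑ f n ≤ ∑ g n
∑-mono zero le = z≤n
∑-mono (suc n) le = +-mono-≤ (le 0 z<s) (∑-mono n (λ i i<n → le (suc i) (s<s i<n)))

∑-zero : ∀ n → ∑ (λ _ → 0) n ≡ 0
∑-zero zero = refl
∑-zero (suc n) = ∑-zero n

∑-split : ∀ a b (f : ℕ → ℕ) → ∑ f (a + b) ≡ ∑ f a + ∑ (λ i → f (a + i)) b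
∑-split zero b f = refl
∑-split (suc a) b f =
  trans (cong (f 0 +_) (∑-split a b (λ i → f (suc i)))) (sym (+-assoc (f 0) _ _))

∑-snoc : ∀ n (f : ℕ → ℕ) → ∑ f (suc n) ≡ ∑ f n + f n
∑-snoc n f = begin
  ∑ f (suc n)                          ≡⟨ cong (∑ f) (+-comm 1 n) ⟩
  ∑ f (n + 1)                          ≡⟨ ∑-split n 1 f ⟩
  ∑ f n + (f (n + 0) + 0)              ≡⟨ cong (λ x → ∑ f n + x) (+-identityʳ _) ⟩
  ∑ f n + f (n + 0)                    ≡⟨ cong (λ j → ∑ f n + f j) (+-identityʳ n) ⟩
  ∑ f n + f n                          ∎
  where open ≡-Reasoning

∑-reverse : ∀ n (f : ℕ → ℕ) → ∑ f n ≡ ∑ (λ i → f (n ∸ suc i)) n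
∑-reverse zero f = refl
∑-reverse (suc n) f = begin
  ∑ f (suc n)                          ≡⟨ ∑-snoc n f ⟩
  ∑ f n + f n                          ≡⟨ cong (_+ f n) (∑-reverse n f) ⟩
  ∑ (λ i → f (n ∸ suc i)) n + f n      ≡⟨ +-comm _ (f n) ⟩
  f n + ∑ (λ i → f (n ∸ suc i)) n      ∎
  where open ≡-Reasoning

∑-+ : ∀ n (f g : ℕ → ℕ) → ∑ (λ i → f i + g i) n ≡ ∑ f n + ∑ g n
∑-+ zero f g = refl
∑-+ (suc n) f g =
  trans (cong (f 0 + g 0 +_) (∑-+ n _ _)) (+-assoc-comm (f 0) (g 0) _ _)
  where
  +-assoc-comm : ∀ a b c d → a + b + (c + d) ≡ a + c + (b + d)
  +-assoc-comm = solve-∀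

∑-*ˡ : ∀ n c (f : ℕ → ℕ) → ∑ (λ i → c * f i) n ≡ c * ∑ f n
∑-*ˡ zero c f = sym (*-zeroʳ c)
∑-*ˡ (suc n) c f = trans (cong (c * f 0 +_) (∑-*ˡ n c _)) (sym (*-distribˡ-+ c _ _))

∑-prefix : ∀ {a n} (f : ℕ → ℕ) → a ≤ n → ∑ f a ≤ ∑ f n
∑-prefix {a} {n} f a≤n = begin
  ∑ f a                                ≤⟨ m≤m+n _ _ ⟩
  ∑ f a + ∑ (λ i → f (a + i)) (n ∸ a)  ≡⟨ ∑-split a (n ∸ a) f ⟨
  ∑ f (a + (n ∸ a))                    ≡⟨ cong (∑ f) (m+[n∸m]≡n a≤n) ⟩
  ∑ f n                                ∎
  where open ≤-Reasoning

-- tail f R d = f d + ⋯ + f (d + R ∸ 1), the mass of f on the window [d, d + R).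
-- When f vanishes from R on, this is the whole upper tail ∑_{j ≥ d} f j.
tail : (ℕ → ℕ) → ℕ → ℕ → ℕ
tail f R d = ∑ (λ i → f (d + i)) R

tail-window : ∀ f R {d a l} → d ≤ a → a + l ≤ d + R → ∑ (λ i → f (a + i)) l ≤ tail f R d
tail-window f R {d} {a} {l} d≤a a+l≤d+R = begin
  ∑ (λ i → f (a + i)) l                               ≡⟨ ∑-cong l (λ i _ → cong (λ x → f (x + i)) a≡d+v) ⟩
  ∑ (λ i → f (d + v + i)) l                           ≡⟨ ∑-cong l (λ i _ → cong f (+-assoc d v i)) ⟩
  ∑ (λ i → f (d + (v + i))) l                         ≤⟨ m≤n+m _ _ ⟩
  ∑ (λ i → f (d + i)) v + ∑ (λ i → f (d + (v + i))) l ≡⟨ ∑-split v l (λ i → f (d + i)) ⟨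
  ∑ (λ i → f (d + i)) (v + l)                         ≤⟨ ∑-prefix (λ i → f (d + i)) v+l≤R ⟩
  tail f R d                                          ∎
  where
  open ≤-Reasoning
  v = a ∸ d
  a≡d+v : a ≡ d + v
  a≡d+v = sym (m+[n∸m]≡n d≤a)
  v+l≤R : v + l ≤ R
  v+l≤R = +-cancelˡ-≤ d _ _ (subst (_≤ d + R) (trans (cong (_+ l) a≡d+v) (+-assoc d v l)) a+l≤d+R)

tail-suc : ∀ f R d → (∀ j → R ≤ j → f j ≡ 0) → tail f R (suc d) ≤ tail f R d
tail-suc f R d vanish = begin
  tail f R (suc d)                     ≡⟨ ∑-cong R (λ i _ → cong f (sym (+-suc d i))) ⟩
  ∑ (λ i → f (d + suc i)) R            ≤⟨ m≤n+m _ _ ⟩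
  ∑ (λ i → f (d + i)) (suc R)          ≡⟨ ∑-snoc R (λ i → f (d + i)) ⟩
  tail f R d + f (d + R)               ≡⟨ cong (tail f R d +_) (vanish (d + R) (m≤n+m R d)) ⟩
  tail f R d + 0                       ≡⟨ +-identityʳ _ ⟩
  tail f R d                           ∎
  where open ≤-Reasoning

tail-antitone : ∀ f R {d d′} → (∀ j → R ≤ j → f j ≡ 0) → d ≤ d′ → tail f R d′ ≤ tail f R d
tail-antitone f R {d} vanish d≤d′ =
  subst (λ x → tail f R x ≤ tail f R d) (m+[n∸m]≡n d≤d′) (moved _)
  where
  moved : ∀ e → tail f R (d + e) ≤ tail f R d
  moved zero = ≤-reflexive (cong (tail f R) (+-identityʳ d))
  moved (suc e) = ≤-trans (≤-trans (≤-reflexive (cong (tail f R) (+-suc d e)))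
                                   (tail-suc f R (d + e) vanish))
                          (moved e)

tail-shift : ∀ f R d g K → g ≤ R →
  (∀ i → i < g → f (d + i) ≤ K * f (d + g + i)) →
  tail f R d ≤ suc K * tail f R (d + g)
tail-shift f R d g K g≤R dominated = begin
  tail f R d                                                 ≡⟨ cong (∑ (λ i → f (d + i))) (m+[n∸m]≡n g≤R) ⟨
  ∑ (λ i → f (d + i)) (g + (R ∸ g))                          ≡⟨ ∑-split g (R ∸ g) _ ⟩
  ∑ (λ i → f (d + i)) g + ∑ (λ i → f (d + (g + i))) (R ∸ g)  ≤⟨ +-mono-≤ head rest ⟩
  K * tail f R (d + g) + tail f R (d + g)                    ≡⟨ +-comm (K * tail f R (d + g)) _ ⟩
  suc K * tail f R (d + g)                                   ∎
  where
  open ≤-Reasoning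
  head : ∑ (λ i → f (d + i)) g ≤ K * tail f R (d + g)
  head = begin
    ∑ (λ i → f (d + i)) g                ≤⟨ ∑-mono g dominated ⟩
    ∑ (λ i → K * f (d + g + i)) g        ≡⟨ ∑-*ˡ g K _ ⟩
    K * ∑ (λ i → f (d + g + i)) g        ≤⟨ *-monoʳ-≤ K (∑-prefix (λ i → f (d + g + i)) g≤R) ⟩
    K * tail f R (d + g)                 ∎
  rest : ∑ (λ i → f (d + (g + i))) (R ∸ g) ≤ tail f R (d + g)
  rest = begin
    ∑ (λ i → f (d + (g + i))) (R ∸ g)    ≡⟨ ∑-cong (R ∸ g) (λ i _ → cong f (+-assoc d g i)) ⟨
    ∑ (λ i → f (d + g + i)) (R ∸ g)      ≤⟨ ∑-prefix (λ i → f (d + g + i)) (m∸n≤m R g) ⟩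
    tail f R (d + g)                     ∎

tail-shift-iterated : ∀ f R d g K B → g ≤ R →
  (∀ b → b < B → ∀ i → i < g → f (d + b * g + i) ≤ K * f (d + b * g + g + i)) →
  tail f R d ≤ suc K ^ B * tail f R (d + B * g)
tail-shift-iterated f R d g K zero g≤R _ =
  ≤-reflexive (sym (trans (+-identityʳ _) (cong (tail f R) (+-identityʳ d))))
tail-shift-iterated f R d g K (suc B) g≤R dominated = begin
  tail f R d
    ≤⟨ tail-shift-iterated f R d g K B g≤R (λ b b<B → dominated b (m<n⇒m<1+n b<B)) ⟩
  suc K ^ B * tail f R (d + B * g)
    ≤⟨ *-monoʳ-≤ (suc K ^ B) (tail-shift f R (d + B * g) g K g≤R (dominated B ≤-refl)) ⟩
  suc K ^ B * (suc K * tail f R (d + B * g + g))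
    ≡⟨ cong (λ x → suc K ^ B * (suc K * tail f R x)) (+-assoc d (B * g) g) ⟩
  suc K ^ B * (suc K * tail f R (d + (B * g + g)))
    ≡⟨ cong (λ x → suc K ^ B * (suc K * tail f R (d + x))) (+-comm (B * g) g) ⟩
  suc K ^ B * (suc K * tail f R (d + suc B * g))
    ≡⟨ *-assoc-comm (suc K ^ B) (suc K) _ ⟩
  suc K ^ suc B * tail f R (d + suc B * g)
    ∎
  where
  open ≤-Reasoning
  *-assoc-comm : ∀ a b c → a * (b * c) ≡ b * a * c
  *-assoc-comm = solve-∀

-- Index bookkeeping for reflecting [0, d) through s: for i < d ≤ s + 1,
-- the point s − (d − 1 − i) is the i-th point of the window starting at s + 1 − d.
reflected-index : ∀ {i d s} → i < d → d ≤ suc s → s ∸ (d ∸ suc i) ≡ (suc s ∸ d) + i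
reflected-index {i} {d} {s} i<d d≤1+s = begin
  s ∸ z              ≡⟨ cong (_∸ z) s≡u+i+z ⟩
  u + i + z ∸ z      ≡⟨ m+n∸n≡m (u + i) z ⟩
  u + i              ∎
  where
  open ≡-Reasoning
  z = d ∸ suc i
  u = suc s ∸ d
  regroup : ∀ u i z → u + (suc i + z) ≡ suc (u + i + z)
  regroup = solve-∀
  s≡u+i+z : s ≡ u + i + z
  s≡u+i+z = suc-injective (begin
    suc s                ≡⟨ m∸n+n≡m d≤1+s ⟨
    u + d                ≡⟨ cong (u +_) (m+[n∸m]≡n i<d) ⟨
    u + (suc i + z)      ≡⟨ regroup u i z ⟩
    suc (u + i + z)      ∎)

-- For f symmetric on [0, s], the total mass is at most twice the tail beyond any
-- point d with 2d ≤ s + 1: the part below d is a mirror image of a part above it.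
tail-symmetric : ∀ f s d → (∀ j → j ≤ s → f j ≡ f (s ∸ j)) → d + d ≤ suc s →
  tail f (suc s) 0 ≤ 2 * tail f (suc s) d
tail-symmetric f s d symmetric 2d≤1+s = begin
  tail f (suc s) 0                      ≡⟨ cong (∑ f) (m+[n∸m]≡n d≤1+s) ⟨
  ∑ f (d + u)                           ≡⟨ ∑-split d u f ⟩
  ∑ f d + ∑ (λ i → f (d + i)) u         ≤⟨ +-mono-≤ lower (∑-prefix (λ i → f (d + i)) (m∸n≤m (suc s) d)) ⟩
  tail f (suc s) d + tail f (suc s) d   ≡⟨ cong (tail f (suc s) d +_) (+-identityʳ _) ⟨
  2 * tail f (suc s) d                  ∎
  where
  open ≤-Reasoning
  d≤1+s : d ≤ suc s
  d≤1+s = ≤-trans (m≤m+n d d) 2d≤1+s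
  u = suc s ∸ d
  d≤u : d ≤ u
  d≤u = +-cancelʳ-≤ d d u (subst (d + d ≤_) (sym (m∸n+n≡m d≤1+s)) 2d≤1+s)
  lower : ∑ f d ≤ tail f (suc s) d
  lower = begin
    ∑ f d                               ≡⟨ ∑-reverse d f ⟩
    ∑ (λ i → f (d ∸ suc i)) d           ≡⟨ ∑-cong d (λ i i<d → symmetric (d ∸ suc i) (below i)) ⟩
    ∑ (λ i → f (s ∸ (d ∸ suc i))) d     ≡⟨ ∑-cong d (λ i i<d → cong f (reflected-index i<d d≤1+s)) ⟩
    ∑ (λ i → f (u + i)) d               ≤⟨ tail-window f (suc s) d≤u (≤-trans (≤-reflexive (m∸n+n≡m d≤1+s)) (m≤n+m (suc s) d)) ⟩
    tail f (suc s) d                    ∎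
    where
    below : ∀ i → d ∸ suc i ≤ s
    below i = m≤n+o⇒m∸n≤o d (suc i) (≤-trans d≤1+s (s≤s (m≤n+m s i)))

bin : ℕ → ℕ → ℕ
bin n zero = 1
bin zero (suc k) = 0
bin (suc n) (suc k) = bin n k + bin n (suc k)

bin≡C : ∀ n k → bin n k ≡ n C k
bin≡C n zero = refl
bin≡C zero (suc k) = refl
bin≡C (suc n) (suc k) =
  trans (cong₂ _+_ (bin≡C n k) (bin≡C n (suc k))) (nCk+nC[k+1]≡[n+1]C[k+1] n k)

bin-vanishes : ∀ n k → n < k → bin n k ≡ 0
bin-vanishes zero (suc k) _ = refl
bin-vanishes (suc n) (suc k) (s≤s n<k) =
  cong₂ _+_ (bin-vanishes n k n<k) (bin-vanishes n (suc k) (m<n⇒m<1+n n<k))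

bin-sym : ∀ n k → k ≤ n → bin n k ≡ bin n (n ∸ k)
bin-sym n k k≤n = trans (bin≡C n k) (trans (nCk≡nC[n∸k] k≤n) (sym (bin≡C n (n ∸ k))))

-- Absorption, in subtraction-free form: (k+1)·C(n,k+1) + k·C(n,k) = n·C(n,k).
bin-absorb : ∀ n k → suc k * bin n (suc k) + k * bin n k ≡ n * bin n k
bin-absorb zero zero = refl
bin-absorb zero (suc k) = cong₂ _+_ (*-zeroʳ (suc (suc k))) (*-zeroʳ (suc k))
bin-absorb (suc n) zero = cong suc (trans (+-identityʳ _) (trans (+-identityʳ _) (trans (bin-1 n) (sym (*-identityʳ n)))))
  where
  bin-1 : ∀ n → bin n 1 ≡ n
  bin-1 zero = refl
  bin-1 (suc n) = cong suc (bin-1 n)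
bin-absorb (suc n) (suc k) = begin
  suc (suc k) * (b + c) + suc k * (a + b)
    ≡⟨ regroup a b c k ⟩
  (suc (suc k) * c + suc k * b) + (suc k * b + k * a) + (a + b)
    ≡⟨ cong₂ (λ x y → x + y + (a + b)) (bin-absorb n (suc k)) (bin-absorb n k) ⟩
  n * b + n * a + (a + b)
    ≡⟨ collect a b n ⟩
  suc n * (a + b) ∎
  where
  open ≡-Reasoning
  a = bin n k
  b = bin n (suc k)
  c = bin n (suc (suc k))
  regroup : ∀ a b c k → suc (suc k) * (b + c) + suc k * (a + b)
                      ≡ (suc (suc k) * c + suc k * b) + (suc k * b + k * a) + (a + b)
  regroup = solve-∀
  collect : ∀ a b n → n * b + n * a + (a + b) ≡ suc n * (a + b)
  collect = solve-∀

bin-absorb-∸ : ∀ n k → suc k * bin n (suc k) ≡ (n ∸ k) * bin n k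
bin-absorb-∸ n k = begin
  suc k * bin n (suc k)                               ≡⟨ m+n∸n≡m _ (k * bin n k) ⟨
  suc k * bin n (suc k) + k * bin n k ∸ k * bin n k   ≡⟨ cong (_∸ k * bin n k) (bin-absorb n k) ⟩
  n * bin n k ∸ k * bin n k                           ≡⟨ *-distribʳ-∸ (bin n k) n k ⟨
  (n ∸ k) * bin n k                                   ∎
  where open ≡-Reasoning

∸-≡ : ∀ {a} b {c} → a ≡ b + c → a ∸ b ≡ c
∸-≡ b {c} refl = m+n∸m≡n b c

-- weight m s j: the number of m-subsets of [2m] meeting a fixed s-subset in
-- exactly j points (a hypergeometric weight).
weight : ℕ → ℕ → ℕ → ℕ
weight m s j = bin s j * bin (m + m ∸ s) (m ∸ j)

weight-vanishes : ∀ m s j → s < j → weight m s j ≡ 0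
weight-vanishes m s j s<j = cong (_* bin (m + m ∸ s) (m ∸ j)) (bin-vanishes s j s<j)

-- upper m s d: the number of m-subsets of [2m] meeting a fixed s-set in at least d points.
upper : ℕ → ℕ → ℕ → ℕ
upper m s = tail (weight m s) (suc s)

-- Since the ground set has size exactly 2m, the weights are symmetric about s/2.
weight-sym : ∀ m s j → s ≤ m → j ≤ s → weight m s j ≡ weight m s (s ∸ j)
weight-sym m s j s≤m j≤s = decompose (s ∸ j) (m ∸ s) (sym (m+[n∸m]≡n j≤s)) (sym (m+[n∸m]≡n s≤m))
  where
  -- with s = j + u and m = s + w the outside set has (u + w) + (j + w) points
  symmetric : ∀ j u w → weight (j + u + w) (j + u) j ≡ weight (j + u + w) (j + u) (j + u ∸ j)
  symmetric j u w = cong₂ _*_ (bin-sym (j + u) j (m≤m+n j u)) (begin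
      bin r (j + u + w ∸ j)             ≡⟨ cong (bin r) (∸-≡ j (+-assoc j u w)) ⟩
      bin r (u + w)                     ≡⟨ bin-sym r (u + w) (subst (u + w ≤_) (sym r≡) (m≤m+n _ _)) ⟩
      bin r (r ∸ (u + w))               ≡⟨ cong (bin r) (∸-≡ (u + w) r≡) ⟩
      bin r (j + w)                     ≡⟨ cong (bin r) (∸-≡ u (regroup₂ j u w)) ⟨
      bin r (j + u + w ∸ u)             ≡⟨ cong (λ x → bin r (j + u + w ∸ x)) (m+n∸m≡n j u) ⟨
      bin r (j + u + w ∸ (j + u ∸ j))   ∎)
    where
    open ≡-Reasoning
    r = j + u + w + (j + u + w) ∸ (j + u)
    regroup₁ : ∀ j u w → j + u + w + (j + u + w) ≡ j + u + (u + w + (j + w))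
    regroup₁ = solve-∀
    regroup₂ : ∀ j u w → j + u + w ≡ u + (j + w)
    regroup₂ = solve-∀
    r≡ : r ≡ u + w + (j + w)
    r≡ = ∸-≡ (j + u) (regroup₁ j u w)
  decompose : ∀ u w → s ≡ j + u → m ≡ s + w → weight m s j ≡ weight m s (s ∸ j)
  decompose u w refl refl = symmetric j u w

weight-ratio : ∀ s w i q → suc (i + q) ≡ s + w →
  weight (s + w) s (suc i) * (suc i * suc (i + w)) ≡ weight (s + w) s i * ((s ∸ i) * suc q)
weight-ratio s w i q 1+i+q≡m = begin
  bin s (suc i) * bin r (m ∸ suc i) * (suc i * suc (i + w))
    ≡⟨ cong₂ (λ a b → bin s (suc i) * bin r a * (suc i * b)) m∸[1+i]≡q (sym r∸q≡) ⟩
  bin s (suc i) * bin r q * (suc i * (r ∸ q))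
    ≡⟨ shuffle₁ (bin s (suc i)) (bin r q) (suc i) (r ∸ q) ⟩
  (suc i * bin s (suc i)) * ((r ∸ q) * bin r q)
    ≡⟨ cong₂ _*_ (bin-absorb-∸ s i) (sym (bin-absorb-∸ r q)) ⟩
  ((s ∸ i) * bin s i) * (suc q * bin r (suc q))
    ≡⟨ shuffle₂ (s ∸ i) (bin s i) (suc q) (bin r (suc q)) ⟩
  bin s i * bin r (suc q) * ((s ∸ i) * suc q)
    ≡⟨ cong (λ a → bin s i * bin r a * ((s ∸ i) * suc q)) m∸i≡1+q ⟨
  bin s i * bin r (m ∸ i) * ((s ∸ i) * suc q)
    ∎
  where
  open ≡-Reasoning
  m = s + w
  r = m + m ∸ s
  regroup₁ : ∀ s w → s + w + (s + w) ≡ s + (s + w + w)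
  regroup₁ = solve-∀
  regroup₂ : ∀ i q w → suc (i + q) + w ≡ q + suc (i + w)
  regroup₂ = solve-∀
  shuffle₁ : ∀ a b c d → a * b * (c * d) ≡ (c * a) * (d * b)
  shuffle₁ = solve-∀
  shuffle₂ : ∀ a b c d → (a * b) * (c * d) ≡ b * d * (a * c)
  shuffle₂ = solve-∀
  m∸[1+i]≡q : m ∸ suc i ≡ q
  m∸[1+i]≡q = ∸-≡ (suc i) (sym 1+i+q≡m)
  m∸i≡1+q : m ∸ i ≡ suc q
  m∸i≡1+q = ∸-≡ i (trans (sym 1+i+q≡m) (sym (+-suc i q)))
  r∸q≡ : r ∸ q ≡ suc (i + w)
  r∸q≡ = ∸-≡ q (trans (∸-≡ s (regroup₁ s w)) (trans (cong (_+ w) (sym 1+i+q≡m)) (regroup₂ i q w)))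

ratio-transfer : ∀ a₀ a₁ α β c d .{{_ : NonZero α}} →
  a₁ * α ≡ a₀ * β → c * α ≤ d * β → a₀ * c ≤ a₁ * d
ratio-transfer a₀ a₁ α β c d ratio cα≤dβ = *-cancelʳ-≤ (a₀ * c) (a₁ * d) α (begin
  a₀ * c * α      ≡⟨ *-assoc a₀ c α ⟩
  a₀ * (c * α)    ≤⟨ *-monoʳ-≤ a₀ cα≤dβ ⟩
  a₀ * (d * β)    ≡⟨ swap a₀ d β ⟩
  d * (a₀ * β)    ≡⟨ cong (d *_) ratio ⟨
  d * (a₁ * α)    ≡⟨ swap d a₁ α ⟩
  a₁ * (d * α)    ≡⟨ *-assoc a₁ d α ⟨
  a₁ * d * α      ∎)
  where
  open ≤-Reasoning
  swap : ∀ a b c → a * (b * c) ≡ b * (a * c)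
  swap = solve-∀

weight-step : ∀ {m s i} w q {c₁ c₂ d₁ d₂} → m ≡ s + w → m ≡ suc i + q →
  c₁ * suc i ≤ d₁ * (s ∸ i) → c₂ * suc (i + w) ≤ d₂ * suc q →
  weight m s i * (c₁ * c₂) ≤ weight m s (suc i) * (d₁ * d₂)
weight-step {s = s} {i} w q {c₁} {c₂} {d₁} {d₂} refl m≡1+i+q le₁ le₂ =
  ratio-transfer (weight (s + w) s i) (weight (s + w) s (suc i)) (suc i * suc (i + w)) ((s ∸ i) * suc q) (c₁ * c₂) (d₁ * d₂)
    (weight-ratio s w i q (sym m≡1+i+q))
    (begin
      c₁ * c₂ * (suc i * suc (i + w))       ≡⟨ interchange c₁ c₂ (suc i) (suc (i + w)) ⟩
      (c₁ * suc i) * (c₂ * suc (i + w))     ≤⟨ *-mono-≤ le₁ le₂ ⟩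
      (d₁ * (s ∸ i)) * (d₂ * suc q)         ≡⟨ interchange d₁ (s ∸ i) d₂ (suc q) ⟩
      d₁ * d₂ * ((s ∸ i) * suc q)           ∎)
  where
  open ≤-Reasoning
  interchange : ∀ a b c d → a * b * (c * d) ≡ (a * c) * (b * d)
  interchange = solve-∀

outside-room : ∀ {m s i} w q → m ≡ s + w → m ≡ suc i + q → s + s ≤ m → i < s →
  (∀ ℓ → suc (i + i) ≤ s + ℓ → i + w ≤ q + ℓ) × s ≤ q
outside-room {m} {s} {i} w q m≡s+w m≡1+i+q 2s≤m i<s = i+w≤q+ℓ , s≤q
  where
  open ≤-Reasoning
  regroup₁ : ∀ i w s → i + w + s ≡ i + (s + w)
  regroup₁ = solve-∀
  regroup₂ : ∀ i q → i + (suc i + q) ≡ suc (i + i) + q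
  regroup₂ = solve-∀
  regroup₃ : ∀ s ℓ q → s + ℓ + q ≡ q + ℓ + s
  regroup₃ = solve-∀
  i+w≤q+ℓ : ∀ ℓ → suc (i + i) ≤ s + ℓ → i + w ≤ q + ℓ
  i+w≤q+ℓ ℓ 2i+1≤s+ℓ = +-cancelʳ-≤ s (i + w) (q + ℓ) (begin
    i + w + s           ≡⟨ regroup₁ i w s ⟩
    i + (s + w)         ≡⟨ cong (i +_) (trans (sym m≡s+w) m≡1+i+q) ⟩
    i + (suc i + q)     ≡⟨ regroup₂ i q ⟩
    suc (i + i) + q     ≤⟨ +-monoˡ-≤ q 2i+1≤s+ℓ ⟩
    s + ℓ + q           ≡⟨ regroup₃ s ℓ q ⟩
    q + ℓ + s           ∎)
  s≤q : s ≤ q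
  s≤q = +-cancelˡ-≤ s s q (begin
    s + s               ≤⟨ 2s≤m ⟩
    m                   ≡⟨ m≡1+i+q ⟩
    suc i + q           ≤⟨ +-monoˡ-≤ q i<s ⟩
    s + q               ∎)

weight-step-crude : ∀ m s i → i < s → s + s ≤ m → weight m s i ≤ (s + s) * weight m s (suc i)
weight-step-crude m s i i<s 2s≤m = begin
  weight m s i                        ≡⟨ *-identityʳ _ ⟨
  weight m s i * (1 * 1)              ≤⟨ weight-step w q {1} {1} {s} {2} m≡s+w m≡1+i+q le₁ le₂ ⟩
  weight m s (suc i) * (s * 2)        ≡⟨ *-comm _ (s * 2) ⟩
  s * 2 * weight m s (suc i)          ≡⟨ cong (_* weight m s (suc i)) (trans (*-comm s 2) (cong (s +_) (+-identityʳ s))) ⟩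
  (s + s) * weight m s (suc i)        ∎
  where
  open ≤-Reasoning
  s≤m : s ≤ m
  s≤m = ≤-trans (m≤m+n s s) 2s≤m
  w = m ∸ s
  q = m ∸ suc i
  m≡s+w : m ≡ s + w
  m≡s+w = sym (m+[n∸m]≡n s≤m)
  m≡1+i+q : m ≡ suc i + q
  m≡1+i+q = sym (m+[n∸m]≡n (≤-trans i<s s≤m))
  room : (∀ ℓ → suc (i + i) ≤ s + ℓ → i + w ≤ q + ℓ) × s ≤ q
  room = outside-room w q m≡s+w m≡1+i+q 2s≤m i<s
  le₁ : 1 * suc i ≤ s * (s ∸ i)
  le₁ = begin
    1 * suc i           ≡⟨ *-identityˡ (suc i) ⟩
    suc i               ≤⟨ i<s ⟩
    s                   ≡⟨ *-identityʳ s ⟨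
    s * 1               ≤⟨ *-monoʳ-≤ s (m<n⇒0<n∸m i<s) ⟩
    s * (s ∸ i)         ∎
  le₂ : 1 * suc (i + w) ≤ 2 * suc q
  le₂ = begin
    1 * suc (i + w)     ≡⟨ *-identityˡ _ ⟩
    suc (i + w)         ≤⟨ s≤s (proj₁ room (suc q) 2i+1≤s+1+q) ⟩
    suc (q + suc q)     ≡⟨ cong (λ x → suc (q + x)) (+-identityʳ (suc q)) ⟨
    2 * suc q           ∎
    where
    2i+1≤s+1+q : suc (i + i) ≤ s + suc q
    2i+1≤s+1+q = ≤-trans (s≤s (+-mono-≤ (<⇒≤ i<s) (≤-trans (<⇒≤ i<s) (proj₂ room)))) (≤-reflexive (sym (+-suc s q)))

half-< : ∀ i s → i + i < s + s → i < s
half-< i s 2i<2s with s ≤? i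
... | yes s≤i = contradiction (+-mono-≤ s≤i s≤i) (<⇒≱ 2i<2s)
... | no s≰i = ≰⇒> s≰i

-- The first linear comparison near the centre: P(i+1) ≤ (s+ℓ+2)(s−i) when P + ℓ = s and
-- 2i + 1 ≤ s + ℓ, because P ≤ 2(s − i) and 2(i + 1) ≤ s + ℓ + 2.
central-left : ∀ s i ℓ P → P + ℓ ≡ s → suc (i + i) ≤ s + ℓ → i < s → P * suc i ≤ (s + ℓ + 2) * (s ∸ i)
central-left s i ℓ P P+ℓ≡s 2i+1≤s+ℓ i<s = *-cancelˡ-≤ 2 (begin
  2 * (P * suc i)      ≡⟨ double P (suc i) ⟩
  P * (suc i + suc i)  ≤⟨ *-mono-≤ P≤2x 2[1+i]≤Q ⟩
  (x + x) * Q          ≡⟨ double′ Q x ⟩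
  2 * (Q * x)          ∎)
  where
  open ≤-Reasoning
  Q = s + ℓ + 2
  x = s ∸ i
  double : ∀ a b → 2 * (a * b) ≡ a * (b + b)
  double = solve-∀
  double′ : ∀ a b → (b + b) * a ≡ 2 * (a * b)
  double′ = solve-∀
  regroup₁ : ∀ P ℓ s → P + (s + ℓ) ≡ P + ℓ + s
  regroup₁ = solve-∀
  regroup₂ : ∀ i x → i + x + (i + x) ≡ x + x + (i + i)
  regroup₂ = solve-∀
  P≤2x : P ≤ x + x
  P≤2x = +-cancelʳ-≤ (i + i) P (x + x) (begin
    P + (i + i)          ≤⟨ +-monoʳ-≤ P (≤-trans (n≤1+n _) 2i+1≤s+ℓ) ⟩
    P + (s + ℓ)          ≡⟨ regroup₁ P ℓ s ⟩
    P + ℓ + s            ≡⟨ cong (_+ s) P+ℓ≡s ⟩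
    s + s                ≡⟨ cong (λ y → y + y) (m+[n∸m]≡n (<⇒≤ i<s)) ⟨
    i + x + (i + x)      ≡⟨ regroup₂ i x ⟩
    x + x + (i + i)      ∎)
  2[1+i]≤Q : suc i + suc i ≤ Q
  2[1+i]≤Q = begin
    suc i + suc i        ≡⟨ cong suc (+-suc i i) ⟩
    suc (suc (i + i))    ≤⟨ s≤s 2i+1≤s+ℓ ⟩
    suc (s + ℓ)          ≤⟨ n≤1+n _ ⟩
    suc (suc (s + ℓ))    ≡⟨ +-comm 2 (s + ℓ) ⟩
    Q                    ∎

weight-step-central : ∀ m s i ℓ P → P + ℓ ≡ s → suc (i + i) ≤ s + ℓ → s + s ≤ m →
  weight m s i * (P * P) ≤ weight m s (suc i) * ((s + ℓ + 2) * (s + ℓ + 2))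
weight-step-central m s i ℓ P P+ℓ≡s 2i+1≤s+ℓ 2s≤m =
  weight-step w q {P} {P} {Q} {Q} m≡s+w m≡1+i+q (central-left s i ℓ P P+ℓ≡s 2i+1≤s+ℓ i<s) right
  where
  open ≤-Reasoning
  Q = s + ℓ + 2
  i<s : i < s
  i<s = half-< i s (≤-trans 2i+1≤s+ℓ (+-monoʳ-≤ s (subst (ℓ ≤_) P+ℓ≡s (m≤n+m ℓ P))))
  s≤m : s ≤ m
  s≤m = ≤-trans (m≤m+n s s) 2s≤m
  w = m ∸ s
  q = m ∸ suc i
  m≡s+w : m ≡ s + w
  m≡s+w = sym (m+[n∸m]≡n s≤m)
  m≡1+i+q : m ≡ suc i + q
  m≡1+i+q = sym (m+[n∸m]≡n (≤-trans i<s s≤m))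
  room : (∀ ℓ → suc (i + i) ≤ s + ℓ → i + w ≤ q + ℓ) × s ≤ q
  room = outside-room w q m≡s+w m≡1+i+q 2s≤m i<s
  P≤1+q : P ≤ suc q
  P≤1+q = ≤-trans (subst (P ≤_) P+ℓ≡s (m≤m+n P ℓ)) (m≤n⇒m≤1+n (proj₂ room))
  collect : ∀ P ℓ y → P * y + y * ℓ + (ℓ + 2) * y ≡ (P + ℓ + ℓ + 2) * y
  collect = solve-∀
  right : P * suc (i + w) ≤ Q * suc q
  right = begin
    P * suc (i + w)           ≤⟨ *-monoʳ-≤ P (s≤s (proj₁ room ℓ 2i+1≤s+ℓ)) ⟩
    P * (suc q + ℓ)           ≡⟨ *-distribˡ-+ P (suc q) ℓ ⟩
    P * suc q + P * ℓ         ≤⟨ +-monoʳ-≤ (P * suc q) (*-monoˡ-≤ ℓ P≤1+q) ⟩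
    P * suc q + suc q * ℓ     ≤⟨ m≤m+n _ _ ⟩
    P * suc q + suc q * ℓ + (ℓ + 2) * suc q ≡⟨ collect P ℓ (suc q) ⟩
    (P + ℓ + ℓ + 2) * suc q   ≡⟨ cong (λ y → (y + ℓ + 2) * suc q) P+ℓ≡s ⟩
    Q * suc q                 ∎

step-chain : ∀ (f : ℕ → ℕ) j g p q → (∀ i → i < g → f (j + i) * p ≤ f (suc (j + i)) * q) →
  f j * p ^ g ≤ f (j + g) * q ^ g
step-chain f j zero p q _ = ≤-reflexive (cong (λ x → f x * 1) (sym (+-identityʳ j)))
step-chain f j (suc g) p q step = begin
  f j * (p * p ^ g)              ≡⟨ rotate (f j) p (p ^ g) ⟩
  (f j * p ^ g) * p              ≤⟨ *-monoˡ-≤ p (step-chain f j g p q (λ i i<g → step i (m<n⇒m<1+n i<g))) ⟩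
  (f (j + g) * q ^ g) * p        ≡⟨ swap (f (j + g)) (q ^ g) p ⟩
  (f (j + g) * p) * q ^ g        ≤⟨ *-monoˡ-≤ (q ^ g) (step g ≤-refl) ⟩
  (f (suc (j + g)) * q) * q ^ g  ≡⟨ cong (λ x → f x * q * q ^ g) (+-suc j g) ⟨
  (f (j + suc g) * q) * q ^ g    ≡⟨ *-assoc (f (j + suc g)) q (q ^ g) ⟩
  f (j + suc g) * (q * q ^ g)    ∎
  where
  open ≤-Reasoning
  rotate : ∀ a p x → a * (p * x) ≡ (a * x) * p
  rotate = solve-∀
  swap : ∀ a x p → (a * x) * p ≡ (a * p) * x
  swap = solve-∀

square-^ : ∀ x g → (x * x) ^ g ≡ x ^ (g + g)
square-^ x zero = refl
square-^ x (suc g) = begin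
  x * x * (x * x) ^ g     ≡⟨ cong (x * x *_) (square-^ x g) ⟩
  x * x * x ^ (g + g)     ≡⟨ *-assoc x x _ ⟩
  x * x ^ suc (g + g)     ≡⟨ cong (λ y → x * x ^ y) (+-suc g g) ⟨
  x * x ^ (g + suc g)     ∎
  where open ≡-Reasoning

power-gap : ∀ P e n → (P + e) ^ suc n ≤ P ^ n * (P + e) + n * e * (P + e) ^ n
power-gap P e zero = ≤-reflexive (trans (*-identityʳ (P + e)) (sym (trans (+-identityʳ _) (*-identityˡ (P + e)))))
power-gap P e (suc n) = begin
  Q * (Q * Qⁿ)                                       ≡⟨ *-distribʳ-+ (Q * Qⁿ) P e ⟩
  P * (Q * Qⁿ) + e * (Q * Qⁿ)                         ≤⟨ +-monoˡ-≤ _ (*-monoʳ-≤ P (power-gap P e n)) ⟩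
  P * (P ^ n * Q + n * e * Qⁿ) + e * (Q * Qⁿ)         ≤⟨ m≤m+n _ _ ⟩
  P * (P ^ n * Q + n * e * Qⁿ) + e * (Q * Qⁿ) + n * e * Qⁿ * e
                                                     ≡⟨ expand P e (P ^ n) Qⁿ n ⟩
  (P * P ^ n) * Q + suc n * e * (Q * Qⁿ)             ∎
  where
  open ≤-Reasoning
  Q = P + e
  Qⁿ = Q ^ n
  expand : ∀ P e Pⁿ Qⁿ n → P * (Pⁿ * (P + e) + n * e * Qⁿ) + e * ((P + e) * Qⁿ) + n * e * Qⁿ * e
                         ≡ (P * Pⁿ) * (P + e) + suc n * e * ((P + e) * Qⁿ)
  expand = solve-∀

power-doubling : ∀ P e n → 1 ≤ P + e → 2 * (n * e) ≤ P + e → (P + e) ^ n ≤ 2 * P ^ n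
power-doubling P e n 1≤Q 2ne≤Q =
  *-cancelʳ-≤ (Q ^ n) (2 * P ^ n) Q {{>-nonZero 1≤Q}}
    (subst (_≤ 2 * P ^ n * Q) (*-comm Q (Q ^ n)) (+-cancelʳ-≤ (Q * Q ^ n) (Q * Q ^ n) _ twice))
  where
  open ≤-Reasoning
  Q = P + e
  regroup : ∀ Pⁿ Q n e Qⁿ → (Pⁿ * Q + n * e * Qⁿ) + (Pⁿ * Q + n * e * Qⁿ) ≡ 2 * Pⁿ * Q + 2 * (n * e) * Qⁿ
  regroup = solve-∀
  twice : Q * Q ^ n + Q * Q ^ n ≤ 2 * P ^ n * Q + Q * Q ^ n
  twice = begin
    Q * Q ^ n + Q * Q ^ n                                          ≤⟨ +-mono-≤ (power-gap P e n) (power-gap P e n) ⟩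
    (P ^ n * Q + n * e * Q ^ n) + (P ^ n * Q + n * e * Q ^ n)      ≡⟨ regroup (P ^ n) Q n e (Q ^ n) ⟩
    2 * P ^ n * Q + 2 * (n * e) * Q ^ n                            ≤⟨ +-monoʳ-≤ (2 * P ^ n * Q) (*-monoˡ-≤ (Q ^ n) 2ne≤Q) ⟩
    2 * P ^ n * Q + Q * Q ^ n                                      ∎

-- Moving g places towards the centre at most halves a weight, provided the block
-- stays within ℓ/2 of the centre (2(j + g) ≤ s + ℓ + 1) and is short compared
-- with s (2·2g·(2ℓ + 2) ≤ s): the g ratios multiply to at most ((s+ℓ+2)/(s−ℓ))^(2g) ≤ 2.
weight-block : ∀ m s j g ℓ → 1 ≤ g → 2 * ((g + g) * (ℓ + ℓ + 2)) ≤ s → s + s ≤ m →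
  (j + g) + (j + g) ≤ suc (s + ℓ) → weight m s j ≤ 2 * weight m s (j + g)
weight-block m s j g ℓ 1≤g short 2s≤m near =
  *-cancelʳ-≤ (weight m s j) (2 * weight m s (j + g)) (P ^ (g + g)) {{m^n≢0 P (g + g) {{>-nonZero 1≤P}}}} (begin
    weight m s j * P ^ (g + g)            ≡⟨ cong (weight m s j *_) (square-^ P g) ⟨
    weight m s j * (P * P) ^ g            ≤⟨ step-chain (weight m s) j g (P * P) (Q * Q) central ⟩
    weight m s (j + g) * (Q * Q) ^ g      ≡⟨ cong (weight m s (j + g) *_) (square-^ Q g) ⟩
    weight m s (j + g) * Q ^ (g + g)      ≤⟨ *-monoʳ-≤ (weight m s (j + g)) (subst (λ x → x ^ (g + g) ≤ 2 * P ^ (g + g)) P+e≡Q Q²ᵍ≤2P²ᵍ) ⟩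
    weight m s (j + g) * (2 * P ^ (g + g)) ≡⟨ rotate (weight m s (j + g)) (P ^ (g + g)) ⟩
    2 * weight m s (j + g) * P ^ (g + g)  ∎)
  where
  open ≤-Reasoning
  e = ℓ + ℓ + 2
  Q = s + ℓ + 2
  rotate : ∀ a x → a * (2 * x) ≡ 2 * a * x
  rotate = solve-∀
  e≤s : e ≤ s
  e≤s = ≤-trans (≤-trans (m≤n*m e (g + g) {{>-nonZero (≤-trans 1≤g (m≤m+n g g))}}) (m≤n*m _ 2)) short
  ℓ<s : ℓ < s
  ℓ<s = ≤-trans (≤-trans (s≤s (m≤m+n ℓ ℓ)) (≤-trans (n≤1+n _) (≤-reflexive (+-comm 2 (ℓ + ℓ))))) e≤s
  P = s ∸ ℓ
  1≤P : 1 ≤ P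
  1≤P = m<n⇒0<n∸m ℓ<s
  P+ℓ≡s : P + ℓ ≡ s
  P+ℓ≡s = m∸n+n≡m (<⇒≤ ℓ<s)
  P+e≡Q : P + e ≡ Q
  P+e≡Q = trans (regroup P ℓ) (cong (λ x → x + ℓ + 2) P+ℓ≡s)
    where regroup : ∀ P ℓ → P + (ℓ + ℓ + 2) ≡ P + ℓ + ℓ + 2
          regroup = solve-∀
  Q²ᵍ≤2P²ᵍ : (P + e) ^ (g + g) ≤ 2 * P ^ (g + g)
  Q²ᵍ≤2P²ᵍ = power-doubling P e (g + g) (≤-trans 1≤P (m≤m+n P e))
    (≤-trans short (≤-trans (m≤m+n s (ℓ + 2)) (≤-reflexive (trans (sym (+-assoc s ℓ 2)) (sym P+e≡Q)))))
  central : ∀ i → i < g → weight m s (j + i) * (P * P) ≤ weight m s (suc (j + i)) * (Q * Q)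
  central i i<g = weight-step-central m s (j + i) ℓ P P+ℓ≡s
    (≤-pred (≤-trans (≤-reflexive (cong suc (sym (+-suc (j + i) (j + i)))))
      (≤-trans (+-mono-≤ j+i<j+g j+i<j+g) near)))
    2s≤m
    where
    j+i<j+g : suc (j + i) ≤ j + g
    j+i<j+g = ≤-trans (≤-reflexive (sym (+-suc j i))) (+-monoʳ-≤ j i<g)

-- In the central regime, the tail beyond d is at most 3^B times the tail beyond d + Bg:
-- B shifts by blocks of length g, each block lying within (B + 1)g of d.
upper-shift-blocks : ∀ m s d g B ℓ → 1 ≤ g → suc B * g + suc B * g ≤ ℓ →
  2 * ((g + g) * (ℓ + ℓ + 2)) ≤ s → s + s ≤ m → d + d ≤ suc s →
  upper m s d ≤ 3 ^ B * upper m s (d + B * g)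
upper-shift-blocks m s d g B ℓ 1≤g 2L≤ℓ short 2s≤m 2d≤1+s =
  tail-shift-iterated (weight m s) (suc s) d g 2 B g≤1+s halves
  where
  open ≤-Reasoning
  g≤1+s : g ≤ suc s
  g≤1+s = ≤-trans (m≤m+n g g) (≤-trans (m≤m*n (g + g) (ℓ + ℓ + 2) {{>-nonZero (≤-trans (s≤s z≤n) (m≤n+m 2 (ℓ + ℓ)))}}) (≤-trans (m≤n*m _ 2) (≤-trans short (n≤1+n s))))
  halves : ∀ b → b < B → ∀ i → i < g → weight m s (d + b * g + i) ≤ 2 * weight m s (d + b * g + g + i)
  halves b b<B i i<g = subst (λ x → weight m s j ≤ 2 * weight m s x) (regroup d (b * g) i g)
    (weight-block m s j g ℓ 1≤g short 2s≤m (begin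
      (j + g) + (j + g)                 ≤⟨ +-mono-≤ j+g≤d+L j+g≤d+L ⟩
      (d + L) + (d + L)                 ≡⟨ interchange d L ⟩
      (d + d) + (L + L)                 ≤⟨ +-mono-≤ 2d≤1+s 2L≤ℓ ⟩
      suc (s + ℓ)                       ∎))
    where
    j = d + b * g + i
    L = suc B * g
    regroup : ∀ d bg i g → d + bg + i + g ≡ d + bg + g + i
    regroup = solve-∀
    interchange : ∀ d L → (d + L) + (d + L) ≡ (d + d) + (L + L)
    interchange = solve-∀
    j+g≤d+L : j + g ≤ d + L
    j+g≤d+L = begin
      d + b * g + i + g                 ≤⟨ +-monoˡ-≤ g (+-monoʳ-≤ (d + b * g) (<⇒≤ i<g)) ⟩
      d + b * g + g + g                 ≡⟨ regroup′ d (b * g) g ⟩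
      d + (g + b * g) + g               ≤⟨ +-monoˡ-≤ g (+-monoʳ-≤ d (*-monoˡ-≤ g b<B)) ⟩
      d + B * g + g                     ≡⟨ regroup″ d B g ⟩
      d + L                             ∎
      where
      regroup′ : ∀ d bg g → d + bg + g + g ≡ d + (g + bg) + g
      regroup′ = solve-∀
      regroup″ : ∀ d B g → d + B * g + g ≡ d + suc B * g
      regroup″ = solve-∀

upper-shift-crude : ∀ m s d h → d + h ≤ s → s + s ≤ m → upper m s d ≤ suc (s + s) ^ h * upper m s (d + h)
upper-shift-crude m s d h d+h≤s 2s≤m =
  subst (λ x → upper m s d ≤ suc (s + s) ^ h * upper m s x) (cong (d +_) (*-identityʳ h))
    (tail-shift-iterated (weight m s) (suc s) d 1 (s + s) h (s≤s z≤n) crude)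
  where
  crude : ∀ b → b < h → ∀ i → i < 1 → weight m s (d + b * 1 + i) ≤ (s + s) * weight m s (d + b * 1 + 1 + i)
  crude b b<h zero _ = subst (λ x → weight m s j ≤ (s + s) * weight m s x) (successor d b)
    (weight-step-crude m s j (≤-trans (≤-reflexive (successor′ d b)) (≤-trans (+-monoʳ-≤ d b<h) d+h≤s)) 2s≤m)
    where
    j = d + b * 1 + 0
    successor : ∀ d b → suc (d + b * 1 + 0) ≡ d + b * 1 + 1 + 0
    successor = solve-∀
    successor′ : ∀ d b → suc (d + b * 1 + 0) ≡ d + suc b
    successor′ = solve-∀
  crude b b<h (suc i) (s≤s ())

blocks : ℕ → ℕ
blocks c = suc (48 * c)

threshold : ℕ → ℕ
threshold c = 24 * suc (blocks c)

shift-constant : ℕ → ℕ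
shift-constant c = 3 ^ blocks c + suc (2 * threshold c) ^ threshold c

-- 24(B + 1)c ≤ B², the inequality that fixes B.
blocks-large : ∀ c → 24 * suc (blocks c) * c ≤ blocks c * blocks c
blocks-large c = begin
  24 * suc B * c                       ≡⟨ expand B c ⟩
  24 * c + 24 * c * B                  ≤⟨ +-monoˡ-≤ (24 * c * B) (m≤m*n (24 * c) B) ⟩
  24 * c * B + 24 * c * B              ≤⟨ m≤n+m _ B ⟩
  B + (24 * c * B + 24 * c * B)        ≡⟨ square c ⟩
  B * B                                ∎
  where
  open ≤-Reasoning
  B = blocks c
  expand : ∀ B c → 24 * suc B * c ≡ 24 * c + 24 * c * B
  expand = solve-∀
  square : ∀ c → suc (48 * c) + (24 * c * suc (48 * c) + 24 * c * suc (48 * c)) ≡ suc (48 * c) * suc (48 * c)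
  square = solve-∀

block-cost : ∀ B g → let ℓ = suc B * suc g + suc B * suc g in
  2 * ((suc g + suc g) * (ℓ + ℓ + 2)) ≤ 24 * suc B * (suc g * suc g)
block-cost B g = begin
  2 * ((G + G) * (ℓ + ℓ + 2))               ≡⟨ expand B G ⟩
  16 * suc B * (G * G) + 8 * G              ≤⟨ +-monoʳ-≤ (16 * suc B * (G * G)) (*-monoʳ-≤ 8 (≤-trans (m≤m*n G G) (m≤n*m (G * G) (suc B)))) ⟩
  16 * suc B * (G * G) + 8 * (suc B * (G * G)) ≡⟨ collect B G ⟩
  24 * suc B * (G * G)                      ∎
  where
  open ≤-Reasoning
  G = suc g
  ℓ = suc B * G + suc B * G
  expand : ∀ B G → 2 * ((G + G) * ((suc B * G + suc B * G) + (suc B * G + suc B * G) + 2)) ≡ 16 * suc B * (G * G) + 8 * G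
  expand = solve-∀
  collect : ∀ B G → 16 * suc B * (G * G) + 8 * (suc B * (G * G)) ≡ 24 * suc B * (G * G)
  collect = solve-∀

-- Blocks of length ⌊h/B⌋ + 1 are short compared with s once s passes the threshold,
-- because B·(⌊h/B⌋ + 1) ≤ 2h (or the block length is 1) and (2h)² ≤ cs.
block-fits : ∀ c s h → threshold c ≤ s → (h + h) * (h + h) ≤ c * s →
  24 * suc (blocks c) * (suc (h / blocks c) * suc (h / blocks c)) ≤ s
block-fits c s h S≤s 4h²≤cs = fits (h / B) (m/n*n≤m h B)
  where
  open ≤-Reasoning
  B = blocks c
  fits : ∀ q → q * B ≤ h → 24 * suc B * (suc q * suc q) ≤ s
  fits zero _ = subst (_≤ s) (sym (*-identityʳ (24 * suc B))) S≤s
  fits (suc q) qB≤h = *-cancelˡ-≤ (B * B) (begin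
    B * B * (24 * suc B * (G * G))        ≡⟨ regroup B G ⟩
    24 * suc B * ((B * G) * (B * G))      ≤⟨ *-monoʳ-≤ (24 * suc B) (≤-trans (*-mono-≤ BG≤2h BG≤2h) 4h²≤cs) ⟩
    24 * suc B * (c * s)                  ≡⟨ *-assoc (24 * suc B) c s ⟨
    24 * suc B * c * s                    ≤⟨ *-monoˡ-≤ s (blocks-large c) ⟩
    B * B * s                             ∎)
    where
    G = suc (suc q)
    regroup : ∀ B G → B * B * (24 * suc B * (G * G)) ≡ 24 * suc B * ((B * G) * (B * G))
    regroup = solve-∀
    double : ∀ B q → B * (q + q) ≡ q * B + q * B
    double = solve-∀
    BG≤2h : B * G ≤ h + h
    BG≤2h = begin
      B * G                       ≤⟨ *-monoʳ-≤ B (s≤s (≤-trans (s≤s (m≤m+n q q)) (≤-reflexive (sym (+-suc q q))))) ⟩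
      B * (suc q + suc q)         ≡⟨ double B (suc q) ⟩
      suc q * B + suc q * B       ≤⟨ +-mono-≤ qB≤h qB≤h ⟩
      h + h                       ∎

upper-shift-central : ∀ m s d h c → threshold c ≤ s → s + s ≤ m → d + d ≤ suc s →
  (h + h) * (h + h) ≤ c * s → upper m s d ≤ 3 ^ blocks c * upper m s (d + h)
upper-shift-central m s d h c S≤s 2s≤m 2d≤1+s 4h²≤cs = begin
  upper m s d                   ≤⟨ upper-shift-blocks m s d g B ℓ (s≤s z≤n) ≤-refl short 2s≤m 2d≤1+s ⟩
  3 ^ B * upper m s (d + B * g) ≤⟨ *-monoʳ-≤ (3 ^ B) (tail-antitone (weight m s) (suc s) (weight-vanishes m s) (+-monoʳ-≤ d h≤Bg)) ⟩
  3 ^ B * upper m s (d + h)     ∎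
  where
  open ≤-Reasoning
  B = blocks c
  g = suc (h / B)
  ℓ = suc B * g + suc B * g
  short : 2 * ((g + g) * (ℓ + ℓ + 2)) ≤ s
  short = ≤-trans (block-cost B (h / B)) (block-fits c s h S≤s 4h²≤cs)
  h≤Bg : h ≤ B * g
  h≤Bg = begin
    h                      ≡⟨ m≡m%n+[m/n]*n h B ⟩
    h % B + h / B * B      ≤⟨ +-monoˡ-≤ (h / B * B) (<⇒≤ (m%n<n h B)) ⟩
    B + h / B * B          ≡⟨ *-comm g B ⟩
    B * g                  ∎

upper-shift : ∀ m s d h c → s + s ≤ m → d + d ≤ suc s → d + h ≤ s →
  (h + h) * (h + h) ≤ c * s → upper m s d ≤ shift-constant c * upper m s (d + h)
upper-shift m s d h c 2s≤m 2d≤1+s d+h≤s 4h²≤cs with threshold c ≤? s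
... | yes S≤s = begin
  upper m s d                        ≤⟨ upper-shift-central m s d h c S≤s 2s≤m 2d≤1+s 4h²≤cs ⟩
  3 ^ blocks c * upper m s (d + h)   ≤⟨ *-monoˡ-≤ (upper m s (d + h)) (m≤m+n (3 ^ blocks c) _) ⟩
  shift-constant c * upper m s (d + h) ∎
  where open ≤-Reasoning
... | no S≰s = begin
  upper m s d                        ≤⟨ upper-shift-crude m s d h d+h≤s 2s≤m ⟩
  suc (s + s) ^ h * upper m s (d + h) ≤⟨ *-monoˡ-≤ (upper m s (d + h)) (≤-trans power≤ (m≤n+m _ (3 ^ blocks c))) ⟩
  shift-constant c * upper m s (d + h) ∎
  where
  open ≤-Reasoning
  S = threshold c
  s≤S : s ≤ S
  s≤S = <⇒≤ (≰⇒> S≰s)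
  power≤ : suc (s + s) ^ h ≤ suc (2 * S) ^ S
  power≤ = ≤-trans (^-monoˡ-≤ h (s≤s (≤-trans (+-mono-≤ s≤S s≤S) (≤-reflexive (cong (S +_) (sym (+-identityʳ S)))))))
                   (^-monoʳ-≤ (suc (2 * S)) (≤-trans (m≤n+m h d) (≤-trans d+h≤s s≤S)))

-- The threshold k lies ⌊t/2⌋ beyond d = k − ⌊t/2⌋, and 2d ≤ s + 1.
upper-from-centre : ∀ m k t c → t ≤ k → 4 * k ≤ m → t * t ≤ c * k →
  upper m (k + k ∸ t) 0 ≤ 2 * shift-constant c * upper m (k + k ∸ t) k
upper-from-centre m k t c t≤k 4k≤m t²≤ck = begin
  upper m s 0                                  ≤⟨ tail-symmetric (weight m s) s d (λ j j≤s → weight-sym m s j s≤m j≤s) 2d≤1+s ⟩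
  2 * upper m s d                              ≤⟨ *-monoʳ-≤ 2 (upper-shift m s d h c 2s≤m 2d≤1+s d+h≤s 4h²≤cs) ⟩
  2 * (shift-constant c * upper m s (d + h))   ≡⟨ cong (λ x → 2 * (shift-constant c * upper m s x)) d+h≡k ⟩
  2 * (shift-constant c * upper m s k)         ≡⟨ *-assoc 2 (shift-constant c) _ ⟨
  2 * shift-constant c * upper m s k           ∎
  where
  open ≤-Reasoning
  s = k + k ∸ t
  h = t / 2
  d = k ∸ h
  halves : ∀ h → h * 2 ≡ h + h
  halves = solve-∀
  t≡ : t ≡ t % 2 + (h + h)
  t≡ = trans (m≡m%n+[m/n]*n t 2) (cong (t % 2 +_) (halves h))
  2h≤t : h + h ≤ t
  2h≤t = subst (h + h ≤_) (sym t≡) (m≤n+m (h + h) (t % 2))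
  h≤k : h ≤ k
  h≤k = ≤-trans (m≤m+n h h) (≤-trans 2h≤t t≤k)
  d+h≡k : d + h ≡ k
  d+h≡k = m∸n+n≡m h≤k
  s+t≡2k : s + t ≡ k + k
  s+t≡2k = m∸n+n≡m (≤-trans t≤k (m≤m+n k k))
  k≤s : k ≤ s
  k≤s = +-cancelʳ-≤ t k s (subst (k + t ≤_) (sym s+t≡2k) (+-monoʳ-≤ k t≤k))
  d+h≤s : d + h ≤ s
  d+h≤s = subst (_≤ s) (sym d+h≡k) k≤s
  2s≤m : s + s ≤ m
  2s≤m = ≤-trans (+-mono-≤ (m∸n≤m (k + k) t) (m∸n≤m (k + k) t)) (≤-trans (≤-reflexive (four k)) 4k≤m)
    where four : ∀ k → k + k + (k + k) ≡ 4 * k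
          four = solve-∀
  s≤m : s ≤ m
  s≤m = ≤-trans (m≤m+n s s) 2s≤m
  4h²≤cs : (h + h) * (h + h) ≤ c * s
  4h²≤cs = ≤-trans (*-mono-≤ 2h≤t 2h≤t) (≤-trans t²≤ck (*-monoʳ-≤ c k≤s))
  regroup : ∀ d h → d + d + (h + h) ≡ (d + h) + (d + h)
  regroup = solve-∀
  2d≤1+s : d + d ≤ suc s
  2d≤1+s = +-cancelʳ-≤ (h + h) (d + d) (suc s) (begin
    d + d + (h + h)             ≡⟨ regroup d h ⟩
    (d + h) + (d + h)           ≡⟨ cong₂ _+_ d+h≡k d+h≡k ⟩
    k + k                       ≡⟨ s+t≡2k ⟨
    s + t                       ≡⟨ cong (s +_) t≡ ⟩
    s + (t % 2 + (h + h))       ≡⟨ +-assoc s (t % 2) (h + h) ⟨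
    s + t % 2 + (h + h)         ≤⟨ +-monoˡ-≤ (h + h) (+-monoʳ-≤ s (≤-pred (m%n<n t 2))) ⟩
    s + 1 + (h + h)             ≡⟨ cong (_+ (h + h)) (+-comm s 1) ⟩
    suc s + (h + h)             ∎)

ind : Bool → ℕ
ind true = 1
ind false = 0

ind-∧-¬T : ∀ {b} c → ¬ T b → ind (b ∧ c) ≡ 0
ind-∧-¬T {false} c _ = refl
ind-∧-¬T {true} c ¬T = ⊥-elim (¬T _)

sumOver : {A : Set} → (A → ℕ) → List A → ℕ
sumOver f [] = 0
sumOver f (x ∷ xs) = f x + sumOver f xs

count : {A : Set} → (A → Bool) → List A → ℕ
count p = sumOver (λ x → ind (p x))

length-filter : {A : Set} (p : A → Bool) (xs : List A) → length (filter (λ x → T? (p x)) xs) ≡ count p xs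
length-filter p [] = refl
length-filter p (x ∷ xs) with p x
... | true = cong suc (length-filter p xs)
... | false = length-filter p xs

sumOver-cong : {A : Set} {f g : A → ℕ} (xs : List A) → (∀ x → f x ≡ g x) → sumOver f xs ≡ sumOver g xs
sumOver-cong [] eq = refl
sumOver-cong (x ∷ xs) eq = cong₂ _+_ (eq x) (sumOver-cong xs eq)

sumOver-mono : {A : Set} {f g : A → ℕ} (xs : List A) → (∀ x → f x ≤ g x) → sumOver f xs ≤ sumOver g xs
sumOver-mono [] le = z≤n
sumOver-mono (x ∷ xs) le = +-mono-≤ (le x) (sumOver-mono xs le)

sumOver-zero : {A : Set} (xs : List A) → sumOver (λ _ → 0) xs ≡ 0
sumOver-zero [] = refl
sumOver-zero (x ∷ xs) = sumOver-zero xs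

sumOver-++ : {A : Set} (f : A → ℕ) (xs ys : List A) → sumOver f (xs ++ ys) ≡ sumOver f xs + sumOver f ys
sumOver-++ f [] ys = refl
sumOver-++ f (x ∷ xs) ys = trans (cong (f x +_) (sumOver-++ f xs ys)) (sym (+-assoc (f x) _ _))

sumOver-map : {A B : Set} (f : B → ℕ) (g : A → B) (xs : List A) → sumOver f (map g xs) ≡ sumOver (λ x → f (g x)) xs
sumOver-map f g [] = refl
sumOver-map f g (x ∷ xs) = cong (f (g x) +_) (sumOver-map f g xs)

∑-sumOver : {A : Set} (f : ℕ → A → ℕ) (R : ℕ) (xs : List A) →
  ∑ (λ i → sumOver (f i) xs) R ≡ sumOver (λ x → ∑ (λ i → f i x) R) xs
∑-sumOver f R [] = ∑-zero R
∑-sumOver f R (x ∷ xs) =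
  trans (∑-+ R (λ i → f i x) (λ i → sumOver (f i) xs)) (cong (∑ (λ i → f i x) R +_) (∑-sumOver f R xs))

sumOver-allSubsets : ∀ n (f : Subset (suc n) → ℕ) →
  sumOver f (allSubsets (suc n))
    ≡ sumOver (λ y → f (inside ∷ y)) (allSubsets n) + sumOver (λ y → f (outside ∷ y)) (allSubsets n)
sumOver-allSubsets n f =
  trans (sumOver-++ f (map (inside ∷_) (allSubsets n)) (map (outside ∷_) (allSubsets n)))
        (cong₂ _+_ (sumOver-map f (inside ∷_) (allSubsets n)) (sumOver-map f (outside ∷_) (allSubsets n)))

count-by-size : ∀ n l → count (λ y → ∣ y ∣ ≡ᵇ l) (allSubsets n) ≡ bin n l
count-by-size zero zero = refl
count-by-size zero (suc l) = refl
count-by-size (suc n) zero =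
  trans (sumOver-allSubsets n (λ y → ind (∣ y ∣ ≡ᵇ 0)))
        (cong₂ _+_ (sumOver-zero (allSubsets n)) (count-by-size n zero))
count-by-size (suc n) (suc l) =
  trans (sumOver-allSubsets n (λ y → ind (∣ y ∣ ≡ᵇ suc l)))
        (cong₂ _+_ (count-by-size n l) (count-by-size n (suc l)))

initial : (n s : ℕ) → Subset n
initial zero s = []
initial (suc n) zero = outside ∷ initial n zero
initial (suc n) (suc s) = inside ∷ initial n s

∣initial∣ : ∀ n s → s ≤ n → ∣ initial n s ∣ ≡ s
∣initial∣ zero zero _ = refl
∣initial∣ (suc n) zero _ = ∣initial∣ n zero z≤n
∣initial∣ (suc n) (suc s) (s≤s s≤n) = cong suc (∣initial∣ n s s≤n)

meet-initial-≤ : ∀ n s (y : Subset n) → ∣ y ∩ initial n s ∣ ≤ s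
meet-initial-≤ zero s [] = z≤n
meet-initial-≤ (suc n) zero (true ∷ y) = meet-initial-≤ n zero y
meet-initial-≤ (suc n) zero (false ∷ y) = meet-initial-≤ n zero y
meet-initial-≤ (suc n) (suc s) (true ∷ y) = s≤s (meet-initial-≤ n s y)
meet-initial-≤ (suc n) (suc s) (false ∷ y) = m≤n⇒m≤1+n (meet-initial-≤ n s y)

count-by-meet : ∀ n s j i → s ≤ n →
  count (λ y → (∣ y ∩ initial n s ∣ ≡ᵇ j) ∧ (∣ y ∣ ≡ᵇ j + i)) (allSubsets n) ≡ bin s j * bin (n ∸ s) i
count-by-meet n zero j i _ = begin
  count (λ y → (∣ y ∩ initial n 0 ∣ ≡ᵇ j) ∧ (∣ y ∣ ≡ᵇ j + i)) (allSubsets n)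
    ≡⟨ sumOver-cong (allSubsets n) (λ y → cong (λ a → ind ((a ≡ᵇ j) ∧ (∣ y ∣ ≡ᵇ j + i))) (meet-initial-0 y)) ⟩
  count (λ y → (0 ≡ᵇ j) ∧ (∣ y ∣ ≡ᵇ j + i)) (allSubsets n)
    ≡⟨ by-size j ⟩
  bin 0 j * bin n i ∎
  where
  open ≡-Reasoning
  meet-initial-0 : ∀ {n} (y : Subset n) → ∣ y ∩ initial n 0 ∣ ≡ 0
  meet-initial-0 y = n≤0⇒n≡0 (meet-initial-≤ _ 0 y)
  by-size : ∀ j → count (λ y → (0 ≡ᵇ j) ∧ (∣ y ∣ ≡ᵇ j + i)) (allSubsets n) ≡ bin 0 j * bin n i
  by-size zero = trans (count-by-size n i) (sym (+-identityʳ _))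
  by-size (suc j) = sumOver-zero (allSubsets n)
count-by-meet (suc n) (suc s) zero i (s≤s s≤n) =
  trans (sumOver-allSubsets n _) (cong₂ _+_ (sumOver-zero (allSubsets n)) (count-by-meet n s 0 i s≤n))
count-by-meet (suc n) (suc s) (suc j) i (s≤s s≤n) =
  trans (sumOver-allSubsets n _)
    (trans (cong₂ _+_ (count-by-meet n s j i s≤n) (count-by-meet n s (suc j) i s≤n))
           (sym (*-distribʳ-+ (bin (n ∸ s) i) (bin s j) (bin s (suc j)))))

count-weight : ∀ m s j → s ≤ m →
  count (λ y → (∣ y ∩ initial (m + m) s ∣ ≡ᵇ j) ∧ (∣ y ∣ ≡ᵇ m)) (allSubsets (m + m)) ≡ weight m s j
count-weight m s j s≤m with j ≤? s
... | yes j≤s = trans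
  (sumOver-cong (allSubsets (m + m))
    (λ y → cong (λ l → ind ((∣ y ∩ initial (m + m) s ∣ ≡ᵇ j) ∧ (∣ y ∣ ≡ᵇ l))) (sym (m+[n∸m]≡n (≤-trans j≤s s≤m)))))
  (count-by-meet (m + m) s j (m ∸ j) (≤-trans s≤m (m≤m+n m m)))
... | no j≰s = trans
  (sumOver-cong (allSubsets (m + m))
    (λ y → ind-∧-¬T (∣ y ∣ ≡ᵇ m) (λ eq → j≰s (subst (_≤ s) (≡ᵇ⇒≡ _ j eq) (meet-initial-≤ (m + m) s y)))))
  (trans (sumOver-zero (allSubsets (m + m))) (sym (weight-vanishes m s j (≰⇒> j≰s))))

ind-≤ᵇ-split : ∀ a d → ind (a ≡ᵇ d) + ind (suc d ≤ᵇ a) ≡ ind (d ≤ᵇ a)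
ind-≤ᵇ-split zero zero = refl
ind-≤ᵇ-split zero (suc d) = refl
ind-≤ᵇ-split (suc a) zero = refl
ind-≤ᵇ-split (suc a) (suc zero) = ind-≤ᵇ-split a zero
ind-≤ᵇ-split (suc a) (suc (suc d)) = ind-≤ᵇ-split a (suc d)

ind-≤ᵇ-below : ∀ a d → a < d → ind (d ≤ᵇ a) ≡ 0
ind-≤ᵇ-below zero (suc d) _ = refl
ind-≤ᵇ-below (suc a) (suc (suc d)) (s≤s a<1+d) = ind-≤ᵇ-below a (suc d) a<1+d

∑-indicator : ∀ R d a → a < d + R → ∑ (λ i → ind (a ≡ᵇ d + i)) R ≡ ind (d ≤ᵇ a)
∑-indicator zero d a a<d+0 = sym (ind-≤ᵇ-below a d (subst (a <_) (+-identityʳ d) a<d+0))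
∑-indicator (suc R) d a a<d+1+R = begin
  ind (a ≡ᵇ d + 0) + ∑ (λ i → ind (a ≡ᵇ d + suc i)) R
    ≡⟨ cong₂ _+_ (cong (λ x → ind (a ≡ᵇ x)) (+-identityʳ d)) (∑-cong R (λ i _ → cong (λ x → ind (a ≡ᵇ x)) (+-suc d i))) ⟩
  ind (a ≡ᵇ d) + ∑ (λ i → ind (a ≡ᵇ suc d + i)) R
    ≡⟨ cong (ind (a ≡ᵇ d) +_) (∑-indicator R (suc d) a (subst (a <_) (+-suc d R) a<d+1+R)) ⟩
  ind (a ≡ᵇ d) + ind (suc d ≤ᵇ a)
    ≡⟨ ind-≤ᵇ-split a d ⟩
  ind (d ≤ᵇ a) ∎
  where open ≡-Reasoning

count-upper : ∀ m s d → s ≤ m →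
  count (λ y → (∣ y ∣ ≡ᵇ m) ∧ (d ≤ᵇ ∣ y ∩ initial (m + m) s ∣)) (allSubsets (m + m)) ≡ upper m s d
count-upper m s d s≤m = sym (begin
  upper m s d
    ≡⟨ ∑-cong (suc s) (λ i _ → sym (count-weight m s (d + i) s≤m)) ⟩
  ∑ (λ i → count (λ y → (∣ y ∩ S ∣ ≡ᵇ d + i) ∧ (∣ y ∣ ≡ᵇ m)) (allSubsets (m + m))) (suc s)
    ≡⟨ ∑-sumOver (λ i y → ind ((∣ y ∩ S ∣ ≡ᵇ d + i) ∧ (∣ y ∣ ≡ᵇ m))) (suc s) (allSubsets (m + m)) ⟩
  sumOver (λ y → ∑ (λ i → ind ((∣ y ∩ S ∣ ≡ᵇ d + i) ∧ (∣ y ∣ ≡ᵇ m))) (suc s)) (allSubsets (m + m))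
    ≡⟨ sumOver-cong (allSubsets (m + m)) (λ y → pointwise (∣ y ∩ S ∣) (∣ y ∣ ≡ᵇ m) (meet-initial-≤ (m + m) s y)) ⟩
  count (λ y → (∣ y ∣ ≡ᵇ m) ∧ (d ≤ᵇ ∣ y ∩ S ∣)) (allSubsets (m + m)) ∎)
  where
  open ≡-Reasoning
  S = initial (m + m) s
  pointwise : ∀ a c → a ≤ s → ∑ (λ i → ind ((a ≡ᵇ d + i) ∧ c)) (suc s) ≡ ind (c ∧ (d ≤ᵇ a))
  pointwise a true a≤s =
    trans (∑-cong (suc s) (λ i _ → cong ind (∧-identityʳ (a ≡ᵇ d + i))))
          (∑-indicator (suc s) d a (≤-trans (s≤s a≤s) (m≤n+m (suc s) d)))
  pointwise a false _ =
    trans (∑-cong (suc s) (λ i _ → cong ind (∧-zeroʳ (a ≡ᵇ d + i)))) (∑-zero (suc s))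

upper-zero : ∀ m s → s ≤ m → upper m s 0 ≡ (m + m) C m
upper-zero m s s≤m = begin
  upper m s 0
    ≡⟨ count-upper m s 0 s≤m ⟨
  count (λ y → (∣ y ∣ ≡ᵇ m) ∧ true) (allSubsets (m + m))
    ≡⟨ sumOver-cong (allSubsets (m + m)) (λ y → cong ind (∧-identityʳ (∣ y ∣ ≡ᵇ m))) ⟩
  count (λ y → ∣ y ∣ ≡ᵇ m) (allSubsets (m + m))
    ≡⟨ count-by-size (m + m) m ⟩
  bin (m + m) m
    ≡⟨ bin≡C (m + m) m ⟩
  (m + m) C m ∎
  where open ≡-Reasoning

∈-allSubsets : ∀ {n} (x : Subset n) → x ∈ allSubsets n
∈-allSubsets [] = here refl
∈-allSubsets (true ∷ x) = ∈-++⁺ˡ (∈-map⁺ (inside ∷_) (∈-allSubsets x))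
∈-allSubsets {suc n} (false ∷ x) = ∈-++⁺ʳ (map (inside ∷_) (allSubsets n)) (∈-map⁺ (outside ∷_) (∈-allSubsets x))

subset-of-size : ∀ {n} (w : Subset n) k → k ≤ ∣ w ∣ → ∃[ x ] (T (x ⊆ᵇ w) × ∣ x ∣ ≡ k)
subset-of-size [] zero _ = [] , _ , refl
subset-of-size (b ∷ w) zero _ with subset-of-size w zero z≤n
... | x , x⊆w , ∣x∣≡0 = outside ∷ x , x⊆w , ∣x∣≡0
subset-of-size (true ∷ w) (suc k) (s≤s k≤∣w∣) with subset-of-size w k k≤∣w∣
... | x , x⊆w , ∣x∣≡k = inside ∷ x , x⊆w , cong suc ∣x∣≡k
subset-of-size (false ∷ w) (suc k) k<∣w∣ with subset-of-size w (suc k) k<∣w∣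
... | x , x⊆w , ∣x∣≡k = outside ∷ x , x⊆w , ∣x∣≡k

⊆ᵇ-∩ : ∀ {n} (x y z : Subset n) → T (x ⊆ᵇ (y ∩ z)) → T (x ⊆ᵇ y) × T (x ⊆ᵇ z)
⊆ᵇ-∩ [] [] [] _ = _ , _
⊆ᵇ-∩ (false ∷ x) (b ∷ y) (c ∷ z) x⊆y∩z = ⊆ᵇ-∩ x y z x⊆y∩z
⊆ᵇ-∩ (true ∷ x) (true ∷ y) (true ∷ z) x⊆y∩z = ⊆ᵇ-∩ x y z x⊆y∩z

size-∩ : ∀ {n} (E F W : Subset n) → T (E ⊆ᵇ W) → T (F ⊆ᵇ W) → ∣ E ∣ + ∣ F ∣ ≤ ∣ E ∩ F ∣ + ∣ W ∣
size-∩ [] [] [] _ _ = z≤n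
size-∩ (true ∷ E) (true ∷ F) (true ∷ W) E⊆W F⊆W =
  s≤s (subst₂ _≤_ (sym (+-suc ∣ E ∣ ∣ F ∣)) (sym (+-suc ∣ E ∩ F ∣ ∣ W ∣)) (s≤s (size-∩ E F W E⊆W F⊆W)))
size-∩ (true ∷ E) (false ∷ F) (true ∷ W) E⊆W F⊆W =
  subst (suc (∣ E ∣ + ∣ F ∣) ≤_) (sym (+-suc ∣ E ∩ F ∣ ∣ W ∣)) (s≤s (size-∩ E F W E⊆W F⊆W))
size-∩ (false ∷ E) (true ∷ F) (true ∷ W) E⊆W F⊆W =
  subst₂ _≤_ (sym (+-suc ∣ E ∣ ∣ F ∣)) (sym (+-suc ∣ E ∩ F ∣ ∣ W ∣)) (s≤s (size-∩ E F W E⊆W F⊆W))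
size-∩ (false ∷ E) (false ∷ F) (true ∷ W) E⊆W F⊆W =
  subst (∣ E ∣ + ∣ F ∣ ≤_) (sym (+-suc ∣ E ∩ F ∣ ∣ W ∣)) (m≤n⇒m≤1+n (size-∩ E F W E⊆W F⊆W))
size-∩ (false ∷ E) (false ∷ F) (false ∷ W) E⊆W F⊆W = size-∩ E F W E⊆W F⊆W

filter-∈-sublists : {A : Set} {P : A → Set} (P? : Decidable P) (xs : List A) → filter P? xs ∈ sublists xs
filter-∈-sublists P? [] = here refl
filter-∈-sublists P? (x ∷ xs) with does (P? x)
... | true = ∈-++⁺ˡ (∈-map⁺ (x ∷_) (filter-∈-sublists P? xs))
... | false = ∈-++⁺ʳ (map (x ∷_) (sublists xs)) (filter-∈-sublists P? xs)

≤-foldr-⊔ : ∀ (xs : List ℕ) {v} → v ∈ xs → v ≤ foldr _⊔_ 0 xs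
≤-foldr-⊔ (x ∷ xs) (here refl) = m≤m⊔n x _
≤-foldr-⊔ (x ∷ xs) (there v∈xs) = ≤-trans (≤-foldr-⊔ xs v∈xs) (m≤n⊔m x _)

shadow-≤-M0 : ∀ n m k t (A : List (Subset n)) → A ∈ sublists (kSubsets n k) →
  T (tIntersectingᵇ t A) → length (nabla n m A) ≤ M0 n m k t
shadow-≤-M0 n m k t A A∈ intersecting =
  ≤-foldr-⊔ _ (∈-map⁺ (λ A → length (nabla n m A)) (∈-filter⁺ (λ A → T? (tIntersectingᵇ t A)) A∈ intersecting))

initialFamily : (n s k : ℕ) → List (Subset n)
initialFamily n s k = filter (λ x → T? (x ⊆ᵇ initial n s)) (kSubsets n k)

∈-initialFamily⁻ : ∀ {n s k E} → E ∈ initialFamily n s k → ∣ E ∣ ≡ k × T (E ⊆ᵇ initial n s)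
∈-initialFamily⁻ {n} {s} {k} {E} E∈ with ∈-filter⁻ (λ x → T? (x ⊆ᵇ initial n s)) {xs = kSubsets n k} E∈
... | E∈kSubsets , E⊆S with ∈-filter⁻ (λ x → T? (∣ x ∣ ≡ᵇ k)) {xs = allSubsets n} E∈kSubsets
... | _ , ∣E∣≡k = ≡ᵇ⇒≡ ∣ E ∣ k ∣E∣≡k , E⊆S

∈-initialFamily⁺ : ∀ {n s k} (E : Subset n) → ∣ E ∣ ≡ k → T (E ⊆ᵇ initial n s) → E ∈ initialFamily n s k
∈-initialFamily⁺ {n} {s} {k} E ∣E∣≡k E⊆S =
  ∈-filter⁺ (λ x → T? (x ⊆ᵇ initial n s))
    (∈-filter⁺ (λ x → T? (∣ x ∣ ≡ᵇ k)) (∈-allSubsets E) (≡⇒≡ᵇ ∣ E ∣ k ∣E∣≡k)) E⊆S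

initialFamily-intersecting : ∀ n s k t → s ≤ n → s + t ≤ k + k → T (tIntersectingᵇ t (initialFamily n s k))
initialFamily-intersecting n s k t s≤n s+t≤2k =
  all⁻ _ (tabulate λ E∈ → all⁻ _ (tabulate λ F∈ → ≤⇒≤ᵇ (meet E∈ F∈)))
  where
  meet : ∀ {E F} → E ∈ initialFamily n s k → F ∈ initialFamily n s k → t ≤ ∣ E ∩ F ∣
  meet {E} {F} E∈ F∈ with ∈-initialFamily⁻ E∈ | ∈-initialFamily⁻ F∈
  ... | ∣E∣≡k , E⊆S | ∣F∣≡k , F⊆S = +-cancelˡ-≤ s t ∣ E ∩ F ∣ (begin
    s + t                      ≤⟨ s+t≤2k ⟩
    k + k                      ≡⟨ cong₂ _+_ ∣E∣≡k ∣F∣≡k ⟨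
    ∣ E ∣ + ∣ F ∣              ≤⟨ size-∩ E F (initial n s) E⊆S F⊆S ⟩
    ∣ E ∩ F ∣ + ∣ initial n s ∣ ≡⟨ cong (∣ E ∩ F ∣ +_) (∣initial∣ n s s≤n) ⟩
    ∣ E ∩ F ∣ + s              ≡⟨ +-comm _ s ⟩
    s + ∣ E ∩ F ∣              ∎)
    where open ≤-Reasoning

initialFamily-covers : ∀ n s k (y : Subset n) → k ≤ ∣ y ∩ initial n s ∣ →
  T (any (λ x → x ⊆ᵇ y) (initialFamily n s k))
initialFamily-covers n s k y k≤ with subset-of-size (y ∩ initial n s) k k≤
... | x , x⊆y∩S , ∣x∣≡k with ⊆ᵇ-∩ x y (initial n s) x⊆y∩S
... | x⊆y , x⊆S = any⁺ _ (lose (∈-initialFamily⁺ x ∣x∣≡k x⊆S) x⊆y)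

upper-≤-shadow : ∀ m s k → s ≤ m → upper m s k ≤ length (nabla (m + m) m (initialFamily (m + m) s k))
upper-≤-shadow m s k s≤m = begin
  upper m s k
    ≡⟨ count-upper m s k s≤m ⟨
  count (λ y → (∣ y ∣ ≡ᵇ m) ∧ (k ≤ᵇ ∣ y ∩ initial (m + m) s ∣)) (allSubsets (m + m))
    ≤⟨ sumOver-mono (allSubsets (m + m)) (λ y → pointwise y (∣ y ∣ ≡ᵇ m)) ⟩
  count (λ y → (∣ y ∣ ≡ᵇ m) ∧ any (λ x → x ⊆ᵇ y) A) (allSubsets (m + m))
    ≡⟨ length-filter (λ y → (∣ y ∣ ≡ᵇ m) ∧ any (λ x → x ⊆ᵇ y) A) (allSubsets (m + m)) ⟨
  length (nabla (m + m) m A) ∎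
  where
  open ≤-Reasoning
  A = initialFamily (m + m) s k
  pointwise : ∀ y c → ind (c ∧ (k ≤ᵇ ∣ y ∩ initial (m + m) s ∣)) ≤ ind (c ∧ any (λ x → x ⊆ᵇ y) A)
  pointwise y false = z≤n
  pointwise y true with k ≤ᵇ ∣ y ∩ initial (m + m) s ∣ in eq
  ... | false = z≤n
  ... | true with any (λ x → x ⊆ᵇ y) A | initialFamily-covers (m + m) s k y (≤ᵇ⇒≤ k _ (subst T (sym eq) _))
  ...   | true | _ = ≤-refl

central-binomial-≤-M0 : ∀ m k t c → t ≤ k → 4 * k ≤ m → t * t ≤ c * k →
  (m + m) C m ≤ 2 * shift-constant c * M0 (m + m) m k t
central-binomial-≤-M0 m k t c t≤k 4k≤m t²≤ck = begin
  (m + m) C m                           ≡⟨ upper-zero m s s≤m ⟨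
  upper m s 0                           ≤⟨ upper-from-centre m k t c t≤k 4k≤m t²≤ck ⟩
  2 * shift-constant c * upper m s k    ≤⟨ *-monoʳ-≤ (2 * shift-constant c) (≤-trans (upper-≤-shadow m s k s≤m) shadow≤M0) ⟩
  2 * shift-constant c * M0 (m + m) m k t ∎
  where
  open ≤-Reasoning
  s = k + k ∸ t
  s≤m : s ≤ m
  s≤m = ≤-trans (m∸n≤m (k + k) t) (≤-trans (≤-trans (m≤m+n (k + k) (k + k)) (≤-reflexive (four k))) 4k≤m)
    where four : ∀ k → k + k + (k + k) ≡ 4 * k
          four = solve-∀
  shadow≤M0 : length (nabla (m + m) m (initialFamily (m + m) s k)) ≤ M0 (m + m) m k t
  shadow≤M0 = shadow-≤-M0 (m + m) m k t _
    (filter-∈-sublists _ (kSubsets (m + m) k))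
    (initialFamily-intersecting (m + m) s k t (≤-trans s≤m (m≤m+n m m)) (≤-reflexive (m∸n+n≡m (≤-trans t≤k (m≤m+n k k)))))

corollary2p6 :
    (k t : ℕ → ℕ) →
    (∀ m → 1 ≤ m → 1 ≤ t m × t m ≤ k m × k m ≤ m) →
    (∀ N → 1 ≤ N → ∃[ m₀ ] (∀ m → m₀ ≤ m → N * k m ≤ m)) →
    (∃[ C ] (∀ m₀ → ∃[ m ] (m₀ ≤ m × t m * t m ≤ C * k m))) →
    ∃[ N ] (1 ≤ N × (∀ m₀ → ∃[ m ] (m₀ ≤ m × (m + m) C m ≤ N * M0 (m + m) m (k m) (t m))))
corollary2p6 k t bounds sublinear (c , often) with sublinear 4 (s≤s z≤n)
... | m₁ , 4k≤m = 2 * shift-constant c , 1≤N , witness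
  where
  1≤N : 1 ≤ 2 * shift-constant c
  1≤N = ≤-trans (m^n>0 3 (blocks c)) (≤-trans (m≤m+n _ _) (m≤n*m _ 2))
  witness : ∀ m₀ → ∃[ m ] (m₀ ≤ m × (m + m) C m ≤ 2 * shift-constant c * M0 (m + m) m (k m) (t m))
  witness m₀ with often (m₀ ⊔ m₁ ⊔ 1)
  ... | m , large , t²≤ck with bounds m (≤-trans (m≤n⊔m (m₀ ⊔ m₁) 1) large)
  ...   | _ , t≤k , _ = m , ≤-trans (≤-trans (m≤m⊔n m₀ m₁) (m≤m⊔n _ 1)) large ,
            central-binomial-≤-M0 m (k m) (t m) c t≤k
              (4k≤m m (≤-trans (≤-trans (m≤n⊔m m₀ m₁) (m≤m⊔n _ 1)) large)) t²≤ck
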